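{- Let $m>1$ and $n>1$ be integers such that the numbers $k(k-1)$ for $k=1,\ldots,n$ are pairwise distinct modulo $m$. (i) Then $m\geqslant 2n-1$. (ii) If $n\geqslant 15$ and $m\leqslant 2.4n$, then $m$ is a prime or a power of two. -}

module Defs where

open import Data.Nat using (ℕ; _*_; _∸_; _%_; _≤_; _<_; NonZero)
open import Relation.Binary.PropositionalEquality using (_≡_)
open import Relation.Nullary using (¬_)

DistinctPronicMod : (m n : ℕ) → .{{NonZero m}} → Set
DistinctPronicMod m n =
  ∀ i j → 1 ≤ i → i < j → j ≤ n → ¬ ((i * (i ∸ 1)) % m ≡ (j * (j ∸ 1)) % m)

module Submission where

-- The whole argument rests on one identity: for 1 ≤ k < j,
--
--     j(j-1) - k(k-1) = (j - k)(j + k - 1),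
--
-- whose two factors have opposite parity and sum 2j - 1.  Read backwards: a
-- product 2r·(2s+1) with r ≥ 1 is such a difference for j = r + s + 1, so if
-- the pronic numbers k(k-1), k = 1..n, are distinct modulo m, then m divides
-- no product 2r·(2s+1) with r ≥ 1 and r + s < n
-- ('evenOddProduct-nondivisible').  Both parts exhibit such a product:
--  (i)  if m ≤ 2n - 2, then m itself (m even) or 2m (m odd) is one;
--  (ii) if m = 2^e·(2s+1) with e, s ≥ 1, then m is one, and if m is odd and
--       composite, m = y·x with y ≥ 2, x ≥ 3 odd, then 2y·x = 2m is one;
--       in both cases 3j ≤ m + 6 bounds the index j = r + s + 1, and for
--       n ≥ 15, 5m ≤ 12n this forces j ≤ n.
-- The remaining numbers m = 2^e and odd primes are exactly the conclusion.

open import Defs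
open import Data.Nat using (ℕ; _*_; _+_; _∸_; _^_; _≤_; _<_; NonZero)
open import Data.Nat.Primality using (Prime)
open import Data.Product using (_×_; ∃-syntax)
open import Data.Sum using (_⊎_)
open import Relation.Binary.PropositionalEquality using (_≡_)

open import Data.Nat using (zero; suc; z≤n; s≤s; s≤s⁻¹; z<s; _≤?_; _%_; nonTrivial⇒n>1; n>1⇒nonTrivial; >-nonZero⁻¹)
open import Data.Nat.Properties
open import Data.Nat.DivMod using ([m+kn]%n≡m%n)
open import Data.Nat.Divisibility using (_∣_; divides; quotient; quotient>1; m∣n⇒n≡quotient*m; ∣-reflexive; m∣m*n; n∣m*n)
open import Data.Nat.Primality using (Composite; composite; prime?; ¬prime⇒composite)
open import Data.Nat.Induction using (<-rec)
open import Data.Nat.Tactic.RingSolver using (solve-∀)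
open import Data.Product using (_,_; ∃₂)
open import Data.Sum using (inj₁; inj₂)
open import Data.Empty using (⊥; ⊥-elim)
open import Function using (_∘_)
open import Relation.Nullary using (¬_; yes; no)
open import Relation.Binary.PropositionalEquality using (refl; sym; trans; cong; subst; module ≡-Reasoning)

data ParityView : ℕ → Set where
  even : ∀ h → ParityView (2 * h)
  odd  : ∀ h → ParityView (1 + 2 * h)

parityView : ∀ m → ParityView m
parityView zero = even 0
parityView (suc m) with parityView m
... | even h = odd h
... | odd h  = subst ParityView (*-suc 2 h) (even (suc h))

twoAdicDecomposition : ∀ m → 0 < m → ∃₂ λ e q → m ≡ 2 ^ e * (1 + 2 * q)
twoAdicDecomposition = <-rec _ λ m rec → split rec (parityView m)
  where
  split : ∀ {m} → (∀ {k} → k < m → 0 < k → ∃₂ λ e q → k ≡ 2 ^ e * (1 + 2 * q)) →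
          ParityView m → 0 < m → ∃₂ λ e q → m ≡ 2 ^ e * (1 + 2 * q)
  split rec (odd q) _ = 0 , q , sym (*-identityˡ (1 + 2 * q))
  split rec (even zero) ()
  split rec (even (suc h)) _ with rec (m<m+n (suc h) z<s) z<s
  ... | e , q , h≡ = suc e , q , trans (cong (2 *_) h≡) (sym (*-assoc 2 (2 ^ e) (1 + 2 * q)))

divisor-of-odd : ∀ {x q} → x ∣ 1 + 2 * q → ∃[ h ] x ≡ 1 + 2 * h
divisor-of-odd {x} {q} x∣odd with parityView x
... | odd h  = h , refl
... | even h = ⊥-elim (even≢odd (quotient x∣odd * h) q (sym (begin
    1 + 2 * q                  ≡⟨ m∣n⇒n≡quotient*m x∣odd ⟩
    quotient x∣odd * (2 * h)   ≡⟨ *-comm-middle (quotient x∣odd) 2 h ⟩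
    2 * (quotient x∣odd * h)   ∎)))
  where
  open ≡-Reasoning
  *-comm-middle : ∀ c a b → c * (a * b) ≡ a * (c * b)
  *-comm-middle = solve-∀

odd>1⇒half≥1 : ∀ h → 1 < 1 + 2 * h → 1 ≤ h
odd>1⇒half≥1 zero    (s≤s ())
odd>1⇒half≥1 (suc h) _ = s≤s z≤n

-- j(j-1) = k(k-1) + (j-k)(j+k-1), written with k = 1 + i and j = k + d.
pronic-step : ∀ i d → (1 + i + d) * (i + d) ≡ (1 + i) * i + d * (d + 2 * i + 1)
pronic-step = solve-∀

module _ {m n : ℕ} .{{_ : NonZero m}} (distinct : DistinctPronicMod m n) where

  pronicGap-nondivisible : ∀ i d → 1 ≤ d → 1 + i + d ≤ n → ¬ m ∣ d * (d + 2 * i + 1)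
  pronicGap-nondivisible i d d≥1 j≤n (divides c gap≡cm) =
    distinct (1 + i) (1 + i + d) (s≤s z≤n) (m<m+n (1 + i) d≥1) j≤n (sym same-residue)
    where
    open ≡-Reasoning
    same-residue : (1 + i + d) * (i + d) % m ≡ (1 + i) * i % m
    same-residue = begin
      (1 + i + d) * (i + d) % m               ≡⟨ cong (_% m) (pronic-step i d) ⟩
      ((1 + i) * i + d * (d + 2 * i + 1)) % m ≡⟨ cong (λ g → ((1 + i) * i + g) % m) gap≡cm ⟩
      ((1 + i) * i + c * m) % m               ≡⟨ [m+kn]%n≡m%n ((1 + i) * i) c m ⟩
      (1 + i) * i % m                         ∎

  -- The product 2r·(2s+1) is the pronic difference for j = r + s + 1 and
  -- k = s - r + 1 (if r ≤ s) or k = r - s (if s < r): the smaller factor is j - k.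
  evenOddProduct-nondivisible : ∀ r s → 1 ≤ r → r + s < n → ¬ m ∣ 2 * r * (1 + 2 * s)
  evenOddProduct-nondivisible r s r≥1 j≤n with ≤-<-connex r s
  ... | inj₁ r≤s with m≤n⇒∃[o]m+o≡n r≤s
  ...   | i , refl = pronicGap-nondivisible i (2 * r) (≤-trans r≥1 (m≤n*m r 2))
                       (subst (_≤ n) (cong suc (even-index r i)) j≤n)
                       ∘ subst (m ∣_) (cong (2 * r *_) (even-factor r i))
    where
    even-index : ∀ r i → r + (r + i) ≡ i + 2 * r
    even-index = solve-∀
    even-factor : ∀ r i → 1 + 2 * (r + i) ≡ 2 * r + 2 * i + 1
    even-factor = solve-∀
  evenOddProduct-nondivisible r s r≥1 j≤n | inj₂ s<r with m≤n⇒∃[o]m+o≡n s<r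
  ...   | i , refl = pronicGap-nondivisible i (1 + 2 * s) (s≤s z≤n)
                       (subst (_≤ n) (cong suc (odd-index s i)) j≤n)
                       ∘ subst (m ∣_) (odd-product s i)
    where
    odd-index : ∀ s i → 1 + s + i + s ≡ i + (1 + 2 * s)
    odd-index = solve-∀
    odd-product : ∀ s i → 2 * (1 + s + i) * (1 + 2 * s) ≡ (1 + 2 * s) * ((1 + 2 * s) + 2 * i + 1)
    odd-product = solve-∀

-- If m + 2 ≤ 2n, then m = 2t is the product 2t·1, and m = 2t + 1 divides 2·(2t+1).
belowBound-impossible : ∀ m n .{{_ : NonZero m}} → DistinctPronicMod m n → 2 + m ≤ 2 * n → ⊥
belowBound-impossible m n distinct bound with parityView m
... | even t = evenOddProduct-nondivisible distinct t 0 t≥1 t<n (m∣m*n 1)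
  where
  t≥1 : 1 ≤ t
  t≥1 = >-nonZero⁻¹ t {{m*n≢0⇒n≢0 2}}
  t<n : t + 0 < n
  t<n = subst (_< n) (sym (+-identityʳ t))
          (*-cancelˡ-< 2 t n (<⇒≤ bound))
... | odd t = evenOddProduct-nondivisible distinct 1 t ≤-refl t+1<n (n∣m*n 2)
  where
  t+1<n : 1 + t < n
  t+1<n = *-cancelˡ-< 2 (1 + t) n (subst (_< 2 * n) (sym (*-suc 2 t)) bound)

lowerBound : ∀ m n .{{_ : NonZero m}} → DistinctPronicMod m n → 2 * n ∸ 1 ≤ m
lowerBound m n distinct with 2 + m ≤? 2 * n
... | yes small = ⊥-elim (belowBound-impossible m n distinct small)
... | no ¬small = ∸-monoˡ-≤ 1 (s≤s⁻¹ (≰⇒> ¬small))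

-- For a = 2 + a', s = 1 + s':  a(2s+1) + 6 - 3(a + s + 1) = s' + 2a's' ≥ 0.
productIndexBound : ∀ a s → 2 ≤ a → 1 ≤ s → 3 * suc (a + s) ≤ a * (1 + 2 * s) + 6
productIndexBound (suc zero) _ (s≤s ()) _
productIndexBound (suc (suc a)) (suc s) _ _ =
  subst (3 * suc (2 + a + suc s) ≤_) (slack a s) (m≤m+n _ (s + 2 * (a * s)))
  where
  slack : ∀ a s → 3 * suc (2 + a + (1 + s)) + (s + 2 * (a * s)) ≡ (2 + a) * (1 + 2 * (1 + s)) + 6
  slack = solve-∀

indexBound : ∀ {m n j} → 15 ≤ n → 5 * m ≤ 12 * n → 3 * j ≤ m + 6 → j ≤ n
indexBound {m} {n} {j} n≥15 5m≤12n 3j≤m+6 = *-cancelˡ-≤ 15 (begin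
  15 * j          ≡⟨ *-assoc 5 3 j ⟩
  5 * (3 * j)     ≤⟨ *-monoʳ-≤ 5 3j≤m+6 ⟩
  5 * (m + 6)     ≡⟨ *-distribˡ-+ 5 m 6 ⟩
  5 * m + 30      ≤⟨ +-mono-≤ 5m≤12n (*-monoʳ-≤ 2 n≥15) ⟩
  12 * n + 2 * n  ≡⟨ *-distribʳ-+ n 12 2 ⟨
  14 * n          ≤⟨ *-monoˡ-≤ n (n≤1+n 14) ⟩
  15 * n          ∎)
  where open ≤-Reasoning

module _ {m n : ℕ} .{{_ : NonZero m}} (distinct : DistinctPronicMod m n)
         (n≥15 : 15 ≤ n) (5m≤12n : 5 * m ≤ 12 * n) where

  evenNonPower-impossible : ∀ r s → 1 ≤ r → 1 ≤ s → m ≡ 2 * r * (1 + 2 * s) → ⊥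
  evenNonPower-impossible r s r≥1 s≥1 m≡ =
    evenOddProduct-nondivisible distinct r s r≥1 (indexBound n≥15 5m≤12n 3j≤m+6) (∣-reflexive m≡)
    where
    open ≤-Reasoning
    3j≤m+6 : 3 * suc (r + s) ≤ m + 6
    3j≤m+6 = begin
      3 * suc (r + s)                 ≤⟨ *-monoʳ-≤ 3 (s≤s (+-monoˡ-≤ s (m≤n*m r 2))) ⟩
      3 * suc (2 * r + s)             ≤⟨ productIndexBound (2 * r) s (*-monoʳ-≤ 2 r≥1) s≥1 ⟩
      2 * r * (1 + 2 * s) + 6         ≡⟨ cong (_+ 6) m≡ ⟨
      m + 6                           ∎

  -- An odd composite m = y·x has x = 2h + 1 ≥ 3 and y ≥ 2, and 2y·x = 2m is forbidden.
  oddComposite-impossible : ∀ q → m ≡ 1 + 2 * q → Composite m → ⊥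
  oddComposite-impossible q m-odd (composite {x} x<m x∣m) with divisor-of-odd {q = q} (subst (x ∣_) m-odd x∣m)
  ... | h , x≡ = evenOddProduct-nondivisible distinct y h (<⇒≤ y≥2)
                   (indexBound n≥15 5m≤12n 3j≤m+6) (subst (m ∣_) 2m≡ (n∣m*n 2))
    where
    y : ℕ
    y = quotient x∣m
    y≥2 : 2 ≤ y
    y≥2 = quotient>1 x∣m x<m
    m≡yx : m ≡ y * (1 + 2 * h)
    m≡yx = trans (m∣n⇒n≡quotient*m x∣m) (cong (y *_) x≡)
    h≥1 : 1 ≤ h
    h≥1 = odd>1⇒half≥1 h (subst (1 <_) x≡ (nonTrivial⇒n>1 x))
    3j≤m+6 : 3 * suc (y + h) ≤ m + 6
    3j≤m+6 = subst (λ p → 3 * suc (y + h) ≤ p + 6) (sym m≡yx) (productIndexBound y h y≥2 h≥1)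
    2m≡ : 2 * m ≡ 2 * y * (1 + 2 * h)
    2m≡ = trans (cong (2 *_) m≡yx) (sym (*-assoc 2 y (1 + 2 * h)))

  primeOrPowerOfTwo : 1 < m → Prime m ⊎ ∃[ e ] m ≡ 2 ^ e
  primeOrPowerOfTwo m>1 with twoAdicDecomposition m (<⇒≤ m>1)
  ... | e , zero , m≡ = inj₂ (e , trans m≡ (*-identityʳ (2 ^ e)))
  ... | suc e , suc q , m≡ = ⊥-elim (evenNonPower-impossible (2 ^ e) (suc q) (m^n>0 2 e) (s≤s z≤n) m≡)
  ... | zero , suc q , m≡ with prime? m
  ...   | yes m-prime = inj₁ m-prime
  ...   | no ¬prime = ⊥-elim (oddComposite-impossible (suc q) (trans m≡ (*-identityˡ _))
                        (¬prime⇒composite {{n>1⇒nonTrivial m>1}} ¬prime))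

-- Theorem 2.1.

theorem2p1 : (m n : ℕ) → .{{_ : NonZero m}} → 1 < m → 1 < n → DistinctPronicMod m n →
    (2 * n ∸ 1 ≤ m) × (15 ≤ n → 5 * m ≤ 12 * n → Prime m ⊎ ∃[ e ] m ≡ 2 ^ e)
theorem2p1 m n m>1 _ distinct =
  lowerBound m n distinct , λ n≥15 5m≤12n → primeOrPowerOfTwo distinct n≥15 5m≤12n m>1
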